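{- If $G$ is a connected proper circular-arc graph with non-bipartite complement, then the closed neighborhood hypergraph $\mathcal{N}[G]$ is strictly connected.
   Context: $\mathcal{N}[G]$ is the hypergraph on $V=V(G)$ with hyperedges $N[v]$ (closed neighborhoods), $v\in V$. A PCA graph is one having a representation by arcs of a circle, adjacency meaning intersection, in which no arc is contained in another. Nonempty sets $A,B\subseteq V$ strictly intersect if $A\subseteq B$, or $B\subseteq A$, or ($A\cap B\neq\emptyset$, neither contains the other, and $A\cup B\neq V$). A hypergraph is strictly connected if every vertex lies in a hyperedge and the graph on the hyperedges with adjacency meaning strict intersection is connected. -}

module Defs where

open import Data.Nat using (ℕ; suc; _+_; _∸_; _<_; _≤_)
open import Data.Nat.DivMod using (_%_)
open import Data.Fin using (Fin; toℕ)
open import Data.Product using (Σ; ∃; _×_; _,_)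
open import Data.Sum using (_⊎_)
open import Data.Bool using (Bool)
open import Relation.Nullary using (¬_; Dec)
open import Relation.Binary.PropositionalEquality using (_≡_; _≢_)
open import Relation.Binary.Construct.Closure.ReflexiveTransitive using (Star)

record Graph (n : ℕ) : Set₁ where
  field
    Adj   : Fin n → Fin n → Set
    sym   : ∀ {u v} → Adj u v → Adj v u
    irrefl : ∀ {u} → ¬ Adj u u
    dec   : ∀ u v → Dec (Adj u v)
open Graph public

Subset : ℕ → Set₁
Subset n = Fin n → Set

_⊆_ : ∀ {n} → Subset n → Subset n → Set
A ⊆ B = ∀ x → A x → B x

NonEmpty : ∀ {n} → Subset n → Set
NonEmpty A = ∃ λ x → A x

StrictlyIntersect : ∀ {n} → Subset n → Subset n → Set
StrictlyIntersect A B =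
  A ⊆ B ⊎ (B ⊆ A ⊎
    ((∃ λ x → A x × B x) × ¬ (A ⊆ B) × ¬ (B ⊆ A) × ¬ (∀ x → A x ⊎ B x)))

ConnectedRel : ∀ {n} → (Fin n → Fin n → Set) → Set
ConnectedRel {n} R = ∀ (u v : Fin n) → Star R u v

Connected : ∀ {n} → Graph n → Set
Connected G = ConnectedRel (Adj G)

ClosedNbhd : ∀ {n} → Graph n → Fin n → Subset n
ClosedNbhd G v u = (u ≡ v) ⊎ Adj G v u

record Hypergraph (n k : ℕ) : Set₁ where
  field
    edge : Fin k → Subset n
open Hypergraph public

StrictlyConnected : ∀ {n k} → Hypergraph n k → Set
StrictlyConnected H =
  (∀ x → ∃ λ e → edge H e x) ×
  ConnectedRel (λ e f → StrictlyIntersect (edge H e) (edge H f))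

𝒩 : ∀ {n} → Graph n → Hypergraph n n
𝒩 G = record { edge = ClosedNbhd G }

ComplAdj : ∀ {n} → Graph n → Fin n → Fin n → Set
ComplAdj G u v = (u ≢ v) × ¬ Adj G u v

Bipartite : ∀ {n} → (Fin n → Fin n → Set) → Set
Bipartite {n} R = Σ (Fin n → Bool) λ c → ∀ u v → R u v → c u ≢ c v

-- Circular arcs on a discrete circle with (suc k) points 0..k (cyclic order).
-- An arc is given by a start point s and a length l with 1 ≤ l ≤ suc k;
-- it consists of the points s, s+1, ..., s+l-1 (mod suc k).
record Arc (k : ℕ) : Set where
  field
    start : Fin (suc k)
    len   : ℕ
    len≥1 : 1 ≤ len
    len≤  : len ≤ suc k
open Arc public

_∈Arc_ : ∀ {k} → Fin (suc k) → Arc k → Set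
_∈Arc_ {k} p a = ((toℕ p + suc k ∸ toℕ (start a)) % suc k) < len a

ArcSubset : ∀ {k} → Arc k → Arc k → Set
ArcSubset a b = ∀ p → p ∈Arc a → p ∈Arc b

ArcsIntersect : ∀ {k} → Arc k → Arc k → Set
ArcsIntersect a b = ∃ λ p → p ∈Arc a × p ∈Arc b

IsPCA : ∀ {n} → Graph n → Set
IsPCA {n} G = ∃ λ k → Σ (Fin n → Arc k) λ arc →
  (∀ u v → u ≢ v → (Adj G u v → ArcsIntersect (arc u) (arc v))
                  × (ArcsIntersect (arc u) (arc v) → Adj G u v))
  × (∀ u v → u ≢ v → ¬ ArcSubset (arc u) (arc v))

{-# OPTIONS --safe #-}
-- Order the arcs of a proper model by their starting points around the circle.
-- Every edge uv of G has, say, the start of v inside the arc of u; the vertices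
-- whose starts lie between those of u and v split uv into consecutive pairs. For
-- a consecutive pair u, v the closed neighbourhoods meet in u, and they cannot
-- cover V: otherwise colouring each vertex by whether its arc contains the start
-- of u would 2-colour the complement, because arcs through a common point, and
-- (by properness) arcs starting inside the arc of v, pairwise intersect. Hence
-- N[u] and N[v] strictly intersect, and connectivity of G carries over.
module Submission where

open import Defs
open import Data.Nat using (ℕ)
open import Relation.Nullary using (¬_)

open import Data.Nat using (suc; _+_; _∸_; _%_; _<_; _≤_; z≤n)
open import Data.Nat.Properties hiding (_≟_)
open import Data.Nat.DivMod using (%-distribˡ-+; [m+n]%n≡m%n; m≤n⇒[n∸m]%m≡n%m; m<n⇒m%n≡m; m%n<n; n%n≡0)
open import Data.Nat.Induction using (<-wellFounded)
open import Data.Fin using (Fin; toℕ; _≟_)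
open import Data.Fin.Properties using (toℕ<n; all?; any?)
open import Data.Product using (_×_; _,_; ∃; proj₁; proj₂)
open import Data.Sum using (_⊎_; inj₁; inj₂; [_,_]′; swap)
open import Data.Empty using (⊥)
open import Function using (_∘_)
open import Induction.WellFounded using (Acc; acc)
open import Relation.Nullary using (Dec; yes; no; contradiction)
open import Relation.Nullary.Decidable using (isYes; _⊎-dec_; _×-dec_; _→-dec_)
open import Relation.Binary.PropositionalEquality
  using (_≡_; _≢_; refl; cong; subst; trans; ≢-sym; module ≡-Reasoning) renaming (sym to ≡-sym)
open import Relation.Binary.Construct.Closure.ReflexiveTransitive using (Star; ε; _◅_; _◅◅_; reverse; _⋆)

strictlyIntersect-sym : ∀ {n} {A B : Subset n} → StrictlyIntersect A B → StrictlyIntersect B A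
strictlyIntersect-sym (inj₁ A⊆B) = inj₂ (inj₁ A⊆B)
strictlyIntersect-sym (inj₂ (inj₁ B⊆A)) = inj₁ B⊆A
strictlyIntersect-sym (inj₂ (inj₂ ((x , Ax , Bx) , A⊈B , B⊈A , ¬cover))) =
  inj₂ (inj₂ ((x , Bx , Ax) , B⊈A , A⊈B , λ cover → ¬cover (λ x → swap (cover x))))

overlap⇒strictlyIntersect : ∀ {n} {A B : Subset n} → (∀ x → Dec (A x)) → (∀ x → Dec (B x)) →
  (∃ λ x → A x × B x) → ¬ (∀ x → A x ⊎ B x) → StrictlyIntersect A B
overlap⇒strictlyIntersect A? B? meet ¬cover with all? (λ x → A? x →-dec B? x)
... | yes A⊆B = inj₁ A⊆B
... | no A⊈B with all? (λ x → B? x →-dec A? x)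
...   | yes B⊆A = inj₂ (inj₁ B⊆A)
...   | no B⊈A = inj₂ (inj₂ (meet , A⊈B , B⊈A , ¬cover))

closedNbhd? : ∀ {n} (G : Graph n) v x → Dec (ClosedNbhd G v x)
closedNbhd? G v x = (x ≟ v) ⊎-dec dec G v x

adj⇒≢ : ∀ {n} (G : Graph n) {u v} → Adj G u v → u ≢ v
adj⇒≢ G uv refl = irrefl G uv

module Circle (k : ℕ) where

  m : ℕ
  m = suc k

  -- δ x y is the clockwise distance from x to y: p ∈Arc a unfolds to δ (start a) p < len a.
  δ : Fin m → Fin m → ℕ
  δ x y = (toℕ y + m ∸ toℕ x) % m

  δ<m : ∀ x y → δ x y < m
  δ<m x y = m%n<n (toℕ y + m ∸ toℕ x) m

  δ-refl : ∀ x → δ x x ≡ 0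
  δ-refl x = trans (cong (_% m) (m+n∸m≡n (toℕ x) m)) (n%n≡0 m)

  δ-+-mod : ∀ x y z → (δ y z + δ x y) % m ≡ δ x z
  δ-+-mod x y z = begin
    (δ y z + δ x y) % m               ≡⟨ %-distribˡ-+ (Z + m ∸ Y) (Y + m ∸ X) m ⟨
    ((Z + m ∸ Y) + (Y + m ∸ X)) % m   ≡⟨ cong (_% m) telescope ⟩
    ((Z + m ∸ X) + m) % m             ≡⟨ [m+n]%n≡m%n (Z + m ∸ X) m ⟩
    δ x z                             ∎
    where
      open ≡-Reasoning
      X = toℕ x
      Y = toℕ y
      Z = toℕ z
      below : ∀ (a : Fin m) b → toℕ a ≤ b + m
      below a b = ≤-trans (<⇒≤ (toℕ<n a)) (m≤n+m m b)
      telescope : (Z + m ∸ Y) + (Y + m ∸ X) ≡ (Z + m ∸ X) + m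
      telescope = begin
        (Z + m ∸ Y) + (Y + m ∸ X)   ≡⟨ +-∸-assoc (Z + m ∸ Y) (below x Y) ⟨
        (Z + m ∸ Y) + (Y + m) ∸ X   ≡⟨ cong (_∸ X) (+-assoc (Z + m ∸ Y) Y m) ⟨
        (Z + m ∸ Y) + Y + m ∸ X     ≡⟨ cong (λ t → t + m ∸ X) (m∸n+n≡m (below y Z)) ⟩
        Z + m + m ∸ X               ≡⟨ +-∸-comm m (below x Z) ⟩
        (Z + m ∸ X) + m             ∎

  δ-+ : ∀ x y z → δ y z + δ x y ≡ δ x z ⊎ δ y z + δ x y ≡ δ x z + m
  δ-+ x y z with δ y z + δ x y <? m
  ... | yes S<m = inj₁ (trans (≡-sym (m<n⇒m%n≡m S<m)) (δ-+-mod x y z))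
  ... | no S≮m = inj₂ (begin
      S             ≡⟨ m∸n+n≡m m≤S ⟨
      (S ∸ m) + m   ≡⟨ cong (_+ m) S∸m≡δ ⟩
      δ x z + m     ∎)
    where
      open ≡-Reasoning
      S = δ y z + δ x y
      m≤S : m ≤ S
      m≤S = ≮⇒≥ S≮m
      S∸m<m : S ∸ m < m
      S∸m<m = subst (S ∸ m <_) (m+n∸n≡m m m) (∸-monoˡ-< (+-mono-< (δ<m y z) (δ<m x y)) m≤S)
      S∸m≡δ : S ∸ m ≡ δ x z
      S∸m≡δ = trans (≡-sym (m<n⇒m%n≡m S∸m<m)) (trans (m≤n⇒[n∸m]%m≡n%m m≤S) (δ-+-mod x y z))

  δ-+-≤ : ∀ x y z → δ x y ≤ δ x z → δ y z + δ x y ≡ δ x z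
  δ-+-≤ x y z le with δ-+ x y z
  ... | inj₁ e = e
  ... | inj₂ e = contradiction (trans e (+-comm (δ x z) m)) (<⇒≢ (+-mono-<-≤ (δ<m y z) le))

  δ-+-> : ∀ x y z → δ x z < δ x y → δ y z + δ x y ≡ δ x z + m
  δ-+-> x y z lt with δ-+ x y z
  ... | inj₂ e = e
  ... | inj₁ e = contradiction (≡-sym e) (<⇒≢ (<-≤-trans lt (m≤n+m (δ x y) (δ y z))))

  δ-cyclic : ∀ x y z → δ x z < δ x y → δ x z + δ y x ≡ δ y z
  δ-cyclic x y z lt = +-cancelʳ-≡ (δ x y) (δ x z + δ y x) (δ y z) (begin
    δ x z + δ y x + δ x y     ≡⟨ +-assoc (δ x z) (δ y x) (δ x y) ⟩
    δ x z + (δ y x + δ x y)   ≡⟨ cong (δ x z +_) (δ-+-> x y x xx<xy) ⟩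
    δ x z + (δ x x + m)       ≡⟨ cong (λ t → δ x z + (t + m)) (δ-refl x) ⟩
    δ x z + m                 ≡⟨ δ-+-> x y z lt ⟨
    δ y z + δ x y             ∎)
    where
      open ≡-Reasoning
      xx<xy : δ x x < δ x y
      xx<xy = subst (_< δ x y) (≡-sym (δ-refl x)) (≤-<-trans z≤n lt)

  δ-shift : ∀ x y z → δ x y ≡ 0 → δ y z ≡ δ x z
  δ-shift x y z xy≡0 = begin
    δ y z           ≡⟨ +-identityʳ (δ y z) ⟨
    δ y z + 0       ≡⟨ cong (δ y z +_) xy≡0 ⟨
    δ y z + δ x y   ≡⟨ δ-+-≤ x y z (subst (_≤ δ x z) (≡-sym xy≡0) z≤n) ⟩
    δ x z           ∎
    where open ≡-Reasoning

  _∈Arc?_ : ∀ p (a : Arc k) → Dec (p ∈Arc a)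
  p ∈Arc? a = δ (start a) p <? len a

  start∈Arc : ∀ a → start a ∈Arc a
  start∈Arc a = subst (_< len a) (≡-sym (δ-refl (start a))) (len≥1 a)

  meet⇒start∈Arc : ∀ a b → ArcsIntersect a b → start b ∈Arc a ⊎ start a ∈Arc b
  meet⇒start∈Arc a b (p , p∈a , p∈b) with δ (start a) (start b) ≤? δ (start a) p
  ... | yes le = inj₁ (≤-<-trans le p∈a)
  ... | no gt = inj₂ (≤-<-trans (subst (δ (start b) (start a) ≤_) (δ-cyclic (start a) (start b) p (≰⇒> gt)) (m≤n+m _ _)) p∈b)

  ∈Arc-after-start : ∀ a b {p} → ¬ ArcSubset b a → start b ∈Arc a →
    δ (start a) (start b) ≤ δ (start a) p → p ∈Arc a → p ∈Arc b
  ∈Arc-after-start a b {p} b⊈a sb∈a sb≤p p∈a with p ∈Arc? b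
  ... | yes p∈b = p∈b
  ... | no p∉b = contradiction b⊆a b⊈a
    where
      open ≤-Reasoning hiding (start)
      b⊆a : ArcSubset b a
      b⊆a t t∈b with δ (start a) (start b) ≤? δ (start a) t
      ... | no gt = <-trans (≰⇒> gt) sb∈a
      ... | yes sb≤t = begin-strict
        δ (start a) t                           ≡⟨ δ-+-≤ (start a) (start b) t sb≤t ⟨
        δ (start b) t + δ (start a) (start b)   <⟨ +-monoˡ-< _ t∈b ⟩
        len b + δ (start a) (start b)           ≤⟨ +-monoˡ-≤ _ (≮⇒≥ p∉b) ⟩
        δ (start b) p + δ (start a) (start b)   ≡⟨ δ-+-≤ (start a) (start b) p sb≤p ⟩
        δ (start a) p                           <⟨ p∈a ⟩
        len a                                   ∎

  sameStart⇒nested : ∀ a b → δ (start a) (start b) ≡ 0 → ArcSubset a b ⊎ ArcSubset b a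
  sameStart⇒nested a b ab≡0 with len a ≤? len b
  ... | yes la≤lb = inj₁ λ p p∈a → subst (_< len b) (≡-sym (δ-shift (start a) (start b) p ab≡0)) (<-≤-trans p∈a la≤lb)
  ... | no la≰lb = inj₂ λ p p∈b → <-trans (subst (_< len b) (δ-shift (start a) (start b) p ab≡0) p∈b) (≰⇒> la≰lb)

module ProperModel {n k : ℕ} (G : Graph n) (arc : Fin n → Arc k)
  (model : ∀ u v → u ≢ v → (Adj G u v → ArcsIntersect (arc u) (arc v))
                         × (ArcsIntersect (arc u) (arc v) → Adj G u v))
  (proper : ∀ u v → u ≢ v → ¬ ArcSubset (arc u) (arc v)) where

  open Circle k

  s : Fin n → Fin m
  s u = start (arc u)

  N : Fin n → Subset n
  N = ClosedNbhd G

  H : Fin n → Fin n → Set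
  H u v = StrictlyIntersect (N u) (N v)

  adj⇒meet : ∀ {u v} → Adj G u v → ArcsIntersect (arc u) (arc v)
  adj⇒meet {u} {v} uv = proj₁ (model u v (adj⇒≢ G uv)) uv

  meet⇒adj : ∀ {u v} → u ≢ v → ArcsIntersect (arc u) (arc v) → Adj G u v
  meet⇒adj {u} {v} u≢v = proj₂ (model u v u≢v)

  δ-starts>0 : ∀ {u v} → u ≢ v → 0 < δ (s u) (s v)
  δ-starts>0 {u} {v} u≢v = n≢0⇒n>0 λ e →
    [ proper u v u≢v , proper v u (≢-sym u≢v) ]′ (sameStart⇒nested (arc u) (arc v) e)

  later-start∈Arc : ∀ {u v w} → s u ∈Arc arc w → δ (s w) (s u) ≤ δ (s w) (s v) →
    s v ∈Arc arc w → s v ∈Arc arc u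
  later-start∈Arc {u} {v} {w} with u ≟ w
  ... | yes refl = λ _ _ v∈w → v∈w
  ... | no u≢w = ∈Arc-after-start (arc w) (arc u) (proper u w u≢w)

  starts∈Arc⇒adj : ∀ {u v w} → u ≢ v → s u ∈Arc arc w → s v ∈Arc arc w → Adj G u v
  starts∈Arc⇒adj {u} {v} {w} u≢v u∈w v∈w with ≤-total (δ (s w) (s u)) (δ (s w) (s v))
  ... | inj₁ le = meet⇒adj u≢v (s v , later-start∈Arc u∈w le v∈w , start∈Arc (arc v))
  ... | inj₂ le = sym G (meet⇒adj (≢-sym u≢v) (s u , later-start∈Arc v∈w le u∈w , start∈Arc (arc u)))

  module Consecutive {u v : Fin n} (u≢v : u ≢ v) (v∈u : s v ∈Arc arc u)
    (noStartBetween : ∀ w → 0 < δ (s u) (s w) → δ (s u) (s w) < δ (s u) (s v) → ⊥) where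

    startAfter-v : ∀ w → ¬ s u ∈Arc arc w → δ (s u) (s v) ≤ δ (s u) (s w)
    startAfter-v w u∉w = ≮⇒≥ (noStartBetween w (n≢0⇒n>0 λ e → u∉w (subst (_< len (arc w))
      (≡-sym (trans (δ-shift (s u) (s w) (s u) e) (δ-refl (s u)))) (len≥1 (arc w)))))

    start∈v : ∀ w → N u w ⊎ N v w → ¬ s u ∈Arc arc w → s w ∈Arc arc v
    start∈v w (inj₁ (inj₁ refl)) u∉w = contradiction (start∈Arc (arc u)) u∉w
    start∈v w (inj₂ (inj₁ refl)) u∉w = start∈Arc (arc v)
    start∈v w (inj₁ (inj₂ uw)) u∉w with meet⇒start∈Arc (arc u) (arc w) (adj⇒meet uw)
    ... | inj₁ w∈u = ∈Arc-after-start (arc u) (arc v) (proper v u (≢-sym u≢v)) v∈u (startAfter-v w u∉w) w∈u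
    ... | inj₂ u∈w = contradiction u∈w u∉w
    start∈v w (inj₂ (inj₂ vw)) u∉w with meet⇒start∈Arc (arc v) (arc w) (adj⇒meet vw)
    ... | inj₁ w∈v = w∈v
    ... | inj₂ v∈w with m≤n⇒m<n∨m≡n (startAfter-v w u∉w)
    ...   | inj₁ uv<uw = contradiction (<-trans wu<wv v∈w) u∉w
      where
        wu<wv : δ (s w) (s u) < δ (s w) (s v)
        wu<wv = subst (δ (s w) (s u) <_) (δ-cyclic (s u) (s w) (s v) uv<uw) (m<n+m _ (δ-starts>0 u≢v))
    ...   | inj₂ uv≡uw = subst (_< len (arc v)) (≡-sym vw≡0) (len≥1 (arc v))
      where
        vw≡0 : δ (s v) (s w) ≡ 0
        vw≡0 = +-cancelʳ-≡ (δ (s u) (s v)) (δ (s v) (s w)) 0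
          (trans (δ-+-≤ (s u) (s v) (s w) (≤-reflexive uv≡uw)) (≡-sym uv≡uw))

    cover⇒bipartite : (∀ x → N u x ⊎ N v x) → Bipartite (ComplAdj G)
    cover⇒bipartite cover = (λ w → isYes (s u ∈Arc? arc w)) , colouring
      where
        colouring : ∀ w w' → ComplAdj G w w' → isYes (s u ∈Arc? arc w) ≢ isYes (s u ∈Arc? arc w')
        colouring w w' (w≢w' , ¬ww') with s u ∈Arc? arc w | s u ∈Arc? arc w'
        ... | yes u∈w | yes u∈w' = λ _ → ¬ww' (meet⇒adj w≢w' (s u , u∈w , u∈w'))
        ... | no u∉w | no u∉w' = λ _ → ¬ww' (starts∈Arc⇒adj w≢w' (start∈v w (cover w) u∉w) (start∈v w' (cover w') u∉w'))
        ... | yes _ | no _ = λ ()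
        ... | no _ | yes _ = λ ()

    strictlyIntersect : ¬ Bipartite (ComplAdj G) → H u v
    strictlyIntersect nb = overlap⇒strictlyIntersect (closedNbhd? G u) (closedNbhd? G v)
      (u , inj₁ refl , inj₂ (meet⇒adj (≢-sym u≢v) (s v , start∈Arc (arc v) , v∈u)))
      (nb ∘ cover⇒bipartite)

  module _ (nb : ¬ Bipartite (ComplAdj G)) where

    start∈Arc⇒H* : ∀ u v → u ≢ v → s v ∈Arc arc u → Acc _<_ (δ (s u) (s v)) → Star H u v
    start∈Arc⇒H* u v u≢v v∈u (acc rec)
      with any? (λ w → (0 <? δ (s u) (s w)) ×-dec (δ (s u) (s w) <? δ (s u) (s v)))
    ... | no none = Consecutive.strictlyIntersect u≢v v∈u (λ w p q → none (w , p , q)) nb ◅ ε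
    ... | yes (w , uw>0 , uw<uv) =
      start∈Arc⇒H* u w u≢w w∈u (rec uw<uv) ◅◅ start∈Arc⇒H* w v w≢v v∈w (rec wv<uv)
      where
        u≢w : u ≢ w
        u≢w refl = <⇒≢ uw>0 (≡-sym (δ-refl (s u)))
        w≢v : w ≢ v
        w≢v refl = <-irrefl refl uw<uv
        w∈u : s w ∈Arc arc u
        w∈u = <-trans uw<uv v∈u
        v∈w : s v ∈Arc arc w
        v∈w = later-start∈Arc w∈u (<⇒≤ uw<uv) v∈u
        wv<uv : δ (s w) (s v) < δ (s u) (s v)
        wv<uv = subst (δ (s w) (s v) <_) (δ-+-≤ (s u) (s w) (s v) (<⇒≤ uw<uv)) (m<m+n _ uw>0)

    adj⇒H* : ∀ {u v} → Adj G u v → Star H u v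
    adj⇒H* {u} {v} uv with meet⇒start∈Arc (arc u) (arc v) (adj⇒meet uv)
    ... | inj₁ v∈u = start∈Arc⇒H* u v (adj⇒≢ G uv) v∈u (<-wellFounded _)
    ... | inj₂ u∈v = reverse strictlyIntersect-sym
                       (start∈Arc⇒H* v u (≢-sym (adj⇒≢ G uv)) u∈v (<-wellFounded _))

theorem3p6 : ∀ {n : ℕ} (G : Graph n) → Connected G → IsPCA G →
    ¬ Bipartite (ComplAdj G) → StrictlyConnected (𝒩 G)
theorem3p6 G connected (k , arc , model , proper) nb =
  (λ x → x , inj₁ refl) , λ u v → (ProperModel.adj⇒H* G arc model proper nb ⋆) (connected u v)
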